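{- Let $\mathbf{T}\in\{0,1\}^{n\times\ell}$ be a matrix all of whose columns are dirty, with $\delta(\mathbf{T})\le 3$. If $\mathcal{T}_3\ne\emptyset$, then $\ell\le|\mathcal{T}_2|+|\mathcal{T}_3|+2$.
   Context: For rows $u,w\in\{0,1\}^\ell$, $D(u,w)=\{j\in[\ell]:u[j]\ne w[j]\}$ and $d(u,w)=|D(u,w)|$. $\delta(\mathbf{T})=\max_{i\ne i'}d(\mathbf{T}[i],\mathbf{T}[i'])$. A column is dirty if it contains both $0$ and $1$. For $x\in\mathbb{N}$, $\mathcal{T}_x$ is the set (without duplicates) $\{D(\mathbf{T}[i],\mathbf{T}[n]) : i\in[n-1],\ d(\mathbf{T}[i],\mathbf{T}[n])=x\}$, where $\mathbf{T}[i]$ denotes the $i$-th row. -}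

module Defs where

open import Data.Nat using (ℕ; suc; _≤_)
import Data.Nat as ℕ
open import Data.Bool using (Bool; true; false; _xor_)
import Data.Bool as Bool
open import Data.Fin using (Fin; inject₁; fromℕ)
open import Data.Fin.Subset using (Subset; ∣_∣)
open import Data.Vec using (tabulate)
open import Data.Vec.Properties using (≡-dec)
open import Data.List using (List; map; filter; deduplicate; allFin)
open import Data.Product using (∃)
open import Relation.Binary.PropositionalEquality using (_≡_; _≢_)

Matrix : ℕ → ℕ → Set
Matrix n ℓ = Fin n → Fin ℓ → Bool

Row : ℕ → Set
Row ℓ = Fin ℓ → Bool

D : ∀ {ℓ} → Row ℓ → Row ℓ → Subset ℓ
D u w = tabulate (λ j → u j xor w j)

d : ∀ {ℓ} → Row ℓ → Row ℓ → ℕ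
d u w = ∣ D u w ∣

δ≤ : ∀ {n ℓ} → Matrix n ℓ → ℕ → Set
δ≤ T k = ∀ i i' → i ≢ i' → d (T i) (T i') ≤ k

Dirty : ∀ {n ℓ} → Matrix n ℓ → Fin ℓ → Set
Dirty T j = (∃ λ i → T i j ≡ true) Data.Product.× (∃ λ i → T i j ≡ false)

-- 𝒯_x for a matrix with suc m rows: the last row is T[n] = T (fromℕ m),
-- the others are T (inject₁ i) for i : Fin m.  Duplicates removed.
𝒯 : ∀ {m ℓ} → Matrix (suc m) ℓ → ℕ → List (Subset ℓ)
𝒯 {m} T x =
  deduplicate (≡-dec Bool._≟_)
    (filter (λ S → ∣ S ∣ ℕ.≟ x)
      (map (λ i → D (T (inject₁ i)) (T (fromℕ m))) (allFin m)))

-- Since D(T[i],T[i₀]) is the symmetric difference Δ i △ S,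
-- each Δ i satisfies |Δ i △ S| ≤ 3 = |S|, which forces at most half of Δ i
-- to lie outside S; with |Δ i| ≤ 3 this gives |Δ i ─ S| ≤ 1, and if
-- Δ i ⊄ S then |Δ i| ≥ 2, i.e. Δ i ∈ 𝒯₂ ∪ 𝒯₃.  Every column is dirty, so
-- it lies in some Δ i; hence the columns are covered by
--   S ∪ ⋃_{Y ∈ 𝒯₂} (Y ─ S) ∪ ⋃_{Y ∈ 𝒯₃} (Y ─ S),
-- a union of sets of size ≤ 1 in which the term S ─ S (for S ∈ 𝒯₃) is empty.
-- Counting gives ℓ ≤ 3 + |𝒯₂| + (|𝒯₃| - 1).
module Submission where

open import Defs
open import Data.Nat using (ℕ; suc; _≤_; _<_; _+_; s≤s; z≤n)
open import Data.Nat.Properties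
  using (≤-reflexive; ≤-trans; +-mono-≤; +-monoʳ-≤; +-monoˡ-≤; +-cancelˡ-≤; +-comm; +-suc; module ≤-Reasoning)
open import Data.Nat.Tactic.RingSolver using (solve-∀)
open import Data.Bool using (Bool; true; false; _xor_)
open import Data.Bool.Properties using (xor-assoc; xor-comm; xor-same)
open import Data.Fin using (Fin; inject₁; fromℕ; toℕ; lower₁; _≟_)
open import Data.Fin.Properties using (toℕ-fromℕ; toℕ-injective; inject₁-lower₁; inject₁-injective; fromℕ≢inject₁)
open import Data.Fin.Subset using (Subset; ∣_∣; _∪_; _∩_; _─_; ⋃; ⊤; ⁅_⁆; _∈_; _⊆_; outside; inside)
open import Data.Fin.Subset.Properties
  using (∣⊥∣≡0; ∣⊤∣≡n; ∣p∣≤∣x∷p∣; p⊆q⇒∣p∣≤∣q∣; p⊆p∪q; q⊆p∪q; x∈p∧x∉q⇒x∈p─q; ∩-comm; ∣⁅x⁆∣≡1; x∈⁅y⁆⇒x≡y; _∈?_)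
open import Data.Vec using (tabulate; lookup; zipWith; []; _∷_)
open import Data.Vec.Properties using (lookup∘tabulate; tabulate∘lookup; tabulate-cong; lookup-zipWith; lookup⇒[]=; ≡-dec)
open import Data.List using (List; length; map; allFin) renaming ([] to []ᴸ; _∷_ to _∷ᴸ_)
open import Data.List.Properties using (length-map)
open import Data.List.Membership.Propositional using () renaming (_∈_ to _∈ᴸ_)
open import Data.List.Membership.Propositional.Properties
  using (∈-map⁺; ∈-map⁻; ∈-filter⁺; ∈-filter⁻; ∈-deduplicate⁺; ∈-deduplicate⁻; ∈-allFin)
open import Data.List.Relation.Unary.Any using (here; there)
open import Data.Product using (∃; _×_; _,_)
open import Data.Sum using (_⊎_; inj₁; inj₂)
open import Function using (_∘_)
open import Relation.Binary.PropositionalEquality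
open import Relation.Nullary using (yes; no; contradiction)
import Data.Bool as Bool
import Data.Nat as ℕ

_△_ : ∀ {n} → Subset n → Subset n → Subset n
_△_ = zipWith _xor_

∣p∪q∣≤∣p∣+∣q∣ : ∀ {n} (p q : Subset n) → ∣ p ∪ q ∣ ≤ ∣ p ∣ + ∣ q ∣
∣p∪q∣≤∣p∣+∣q∣ [] [] = z≤n
∣p∪q∣≤∣p∣+∣q∣ (inside ∷ p) (s ∷ q) =
  s≤s (≤-trans (∣p∪q∣≤∣p∣+∣q∣ p q) (+-monoʳ-≤ ∣ p ∣ (∣p∣≤∣x∷p∣ s q)))
∣p∪q∣≤∣p∣+∣q∣ (outside ∷ p) (outside ∷ q) = ∣p∪q∣≤∣p∣+∣q∣ p q
∣p∪q∣≤∣p∣+∣q∣ (outside ∷ p) (inside ∷ q) =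
  subst (suc ∣ p ∪ q ∣ ≤_) (sym (+-suc ∣ p ∣ ∣ q ∣)) (s≤s (∣p∪q∣≤∣p∣+∣q∣ p q))

∣p∣≡∣p─q∣+∣p∩q∣ : ∀ {n} (p q : Subset n) → ∣ p ∣ ≡ ∣ p ─ q ∣ + ∣ p ∩ q ∣
∣p∣≡∣p─q∣+∣p∩q∣ [] [] = refl
∣p∣≡∣p─q∣+∣p∩q∣ (inside ∷ p) (inside ∷ q) =
  trans (cong suc (∣p∣≡∣p─q∣+∣p∩q∣ p q)) (sym (+-suc ∣ p ─ q ∣ ∣ p ∩ q ∣))
∣p∣≡∣p─q∣+∣p∩q∣ (inside ∷ p) (outside ∷ q) = cong suc (∣p∣≡∣p─q∣+∣p∩q∣ p q)
∣p∣≡∣p─q∣+∣p∩q∣ (outside ∷ p) (inside ∷ q) = ∣p∣≡∣p─q∣+∣p∩q∣ p q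
∣p∣≡∣p─q∣+∣p∩q∣ (outside ∷ p) (outside ∷ q) = ∣p∣≡∣p─q∣+∣p∩q∣ p q

∣p△q∣≡∣p─q∣+∣q─p∣ : ∀ {n} (p q : Subset n) → ∣ p △ q ∣ ≡ ∣ p ─ q ∣ + ∣ q ─ p ∣
∣p△q∣≡∣p─q∣+∣q─p∣ [] [] = refl
∣p△q∣≡∣p─q∣+∣q─p∣ (inside ∷ p) (inside ∷ q) = ∣p△q∣≡∣p─q∣+∣q─p∣ p q
∣p△q∣≡∣p─q∣+∣q─p∣ (inside ∷ p) (outside ∷ q) = cong suc (∣p△q∣≡∣p─q∣+∣q─p∣ p q)
∣p△q∣≡∣p─q∣+∣q─p∣ (outside ∷ p) (inside ∷ q) =
  trans (cong suc (∣p△q∣≡∣p─q∣+∣q─p∣ p q)) (sym (+-suc ∣ p ─ q ∣ ∣ q ─ p ∣))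
∣p△q∣≡∣p─q∣+∣q─p∣ (outside ∷ p) (outside ∷ q) = ∣p△q∣≡∣p─q∣+∣q─p∣ p q

∣p─p∣≡0 : ∀ {n} (p : Subset n) → ∣ p ─ p ∣ ≡ 0
∣p─p∣≡0 [] = refl
∣p─p∣≡0 (inside ∷ p) = ∣p─p∣≡0 p
∣p─p∣≡0 (outside ∷ p) = ∣p─p∣≡0 p

x∈p⇒1≤∣p∣ : ∀ {n} {x : Fin n} {p : Subset n} → x ∈ p → 1 ≤ ∣ p ∣
x∈p⇒1≤∣p∣ {x = x} {p} x∈p = subst (_≤ ∣ p ∣) (∣⁅x⁆∣≡1 x) (p⊆q⇒∣p∣≤∣q∣ ⁅x⁆⊆p)
  where
    ⁅x⁆⊆p : ⁅ x ⁆ ⊆ p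
    ⁅x⁆⊆p y∈⁅x⁆ = subst (_∈ p) (sym (x∈⁅y⁆⇒x≡y x y∈⁅x⁆)) x∈p

-- If X differs from S in at most |S| places, then at most half of X lies
-- outside S: from |X─S| + |S─X| ≤ |S| = |S─X| + |S∩X| we get |X─S| ≤ |X∩S|.
half-outside : ∀ {n} (X S : Subset n) → ∣ X △ S ∣ ≤ ∣ S ∣ → ∣ X ─ S ∣ + ∣ X ─ S ∣ ≤ ∣ X ∣
half-outside X S close = begin
  a + a  ≤⟨ +-monoʳ-≤ a a≤c ⟩
  a + c  ≡⟨ ∣p∣≡∣p─q∣+∣p∩q∣ X S ⟨
  ∣ X ∣  ∎
  where
    open ≤-Reasoning
    a = ∣ X ─ S ∣
    b = ∣ S ─ X ∣
    c = ∣ X ∩ S ∣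
    a≤c : a ≤ c
    a≤c = +-cancelˡ-≤ b a c (begin
      b + a          ≡⟨ +-comm b a ⟩
      a + b          ≡⟨ ∣p△q∣≡∣p─q∣+∣q─p∣ X S ⟨
      ∣ X △ S ∣      ≤⟨ close ⟩
      ∣ S ∣          ≡⟨ ∣p∣≡∣p─q∣+∣p∩q∣ S X ⟩
      b + ∣ S ∩ X ∣  ≡⟨ cong (λ Y → b + ∣ Y ∣) (∩-comm S X) ⟩
      b + c          ∎)

∈ᴸ⇒⊆⋃ : ∀ {n} {p : Subset n} {ps : List (Subset n)} → p ∈ᴸ ps → p ⊆ ⋃ ps
∈ᴸ⇒⊆⋃ {ps = q ∷ᴸ ps} (here refl) = p⊆p∪q (⋃ ps)
∈ᴸ⇒⊆⋃ {ps = q ∷ᴸ ps} (there p∈ps) = q⊆p∪q q (⋃ ps) ∘ ∈ᴸ⇒⊆⋃ p∈ps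

∣⋃∣≤length : ∀ {n} (ps : List (Subset n)) → (∀ {p} → p ∈ᴸ ps → ∣ p ∣ ≤ 1) → ∣ ⋃ ps ∣ ≤ length ps
∣⋃∣≤length {n} []ᴸ _ = ≤-reflexive (∣⊥∣≡0 n)
∣⋃∣≤length (p ∷ᴸ ps) small = ≤-trans (∣p∪q∣≤∣p∣+∣q∣ p (⋃ ps))
  (+-mono-≤ (small (here refl)) (∣⋃∣≤length ps (small ∘ there)))

∣⋃∣<length : ∀ {n} (ps : List (Subset n)) → (∀ {p} → p ∈ᴸ ps → ∣ p ∣ ≤ 1)
           → ∀ {q} → q ∈ᴸ ps → ∣ q ∣ ≡ 0 → ∣ ⋃ ps ∣ < length ps
∣⋃∣<length (p ∷ᴸ ps) small (here refl) empty = s≤s (begin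
  ∣ p ∪ ⋃ ps ∣       ≤⟨ ∣p∪q∣≤∣p∣+∣q∣ p (⋃ ps) ⟩
  ∣ p ∣ + ∣ ⋃ ps ∣   ≡⟨ cong (_+ ∣ ⋃ ps ∣) empty ⟩
  ∣ ⋃ ps ∣           ≤⟨ ∣⋃∣≤length ps (small ∘ there) ⟩
  length ps          ∎)
  where open ≤-Reasoning
∣⋃∣<length (p ∷ᴸ ps) small (there q∈ps) empty = s≤s (begin
  ∣ p ∪ ⋃ ps ∣       ≤⟨ ∣p∪q∣≤∣p∣+∣q∣ p (⋃ ps) ⟩
  ∣ p ∣ + ∣ ⋃ ps ∣   ≤⟨ +-monoˡ-≤ ∣ ⋃ ps ∣ (small (here refl)) ⟩
  suc ∣ ⋃ ps ∣       ≤⟨ ∣⋃∣<length ps (small ∘ there) q∈ps empty ⟩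
  length ps          ∎)
  where open ≤-Reasoning

a+a≤3⇒a≤1 : ∀ a → a + a ≤ 3 → a ≤ 1
a+a≤3⇒a≤1 0 _ = z≤n
a+a≤3⇒a≤1 1 _ = s≤s z≤n
a+a≤3⇒a≤1 (suc (suc a)) le =
  contradiction (≤-trans (+-mono-≤ 2≤2+a 2≤2+a) le) λ { (s≤s (s≤s (s≤s ()))) }
  where
    2≤2+a : 2 ≤ suc (suc a)
    2≤2+a = s≤s (s≤s z≤n)

2≤x≤3 : ∀ {x} → 2 ≤ x → x ≤ 3 → x ≡ 2 ⊎ x ≡ 3
2≤x≤3 {0} () _
2≤x≤3 {1} (s≤s ()) _
2≤x≤3 {2} _ _ = inj₁ refl
2≤x≤3 {3} _ _ = inj₂ refl
2≤x≤3 {suc (suc (suc (suc _)))} _ (s≤s (s≤s (s≤s ())))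

inject₁-onto : ∀ {m} (k : Fin (suc m)) → k ≢ fromℕ m → ∃ λ i → inject₁ i ≡ k
inject₁-onto {m} k k≢last = lower₁ k m≢k , inject₁-lower₁ k m≢k
  where
    m≢k : m ≢ toℕ k
    m≢k m≡k = k≢last (toℕ-injective (trans (sym m≡k) (sym (toℕ-fromℕ m))))

nonempty : ∀ {A : Set} {xs : List A} → xs ≢ []ᴸ → ∃ λ x → x ∈ᴸ xs
nonempty {xs = []ᴸ} xs≢[] = contradiction refl xs≢[]
nonempty {xs = x ∷ᴸ _} _ = x , here refl

xor-cancelʳ : ∀ x y z → (x xor z) xor (y xor z) ≡ x xor y
xor-cancelʳ x y z = begin
  (x xor z) xor (y xor z)  ≡⟨ xor-assoc x z (y xor z) ⟩
  x xor (z xor (y xor z))  ≡⟨ cong (λ w → x xor (z xor w)) (xor-comm y z) ⟩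
  x xor (z xor (z xor y))  ≡⟨ cong (x xor_) (xor-assoc z z y) ⟨
  x xor ((z xor z) xor y)  ≡⟨ cong (λ w → x xor (w xor y)) (xor-same z) ⟩
  x xor y                  ∎
  where open ≡-Reasoning

xor-≢ : ∀ {x y} → x ≢ y → x xor y ≡ true
xor-≢ {false} {false} x≢y = contradiction refl x≢y
xor-≢ {false} {true} _ = refl
xor-≢ {true} {false} _ = refl
xor-≢ {true} {true} x≢y = contradiction refl x≢y

D-△ : ∀ {ℓ} (u v w : Row ℓ) → D u w △ D v w ≡ D u v
D-△ u v w = begin
  D u w △ D v w                      ≡⟨ tabulate∘lookup (D u w △ D v w) ⟨
  tabulate (lookup (D u w △ D v w))  ≡⟨ tabulate-cong pointwise ⟩
  D u v                              ∎
  where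
    open ≡-Reasoning
    pointwise : ∀ j → lookup (D u w △ D v w) j ≡ u j xor v j
    pointwise j = begin
      lookup (D u w △ D v w) j               ≡⟨ lookup-zipWith _xor_ j (D u w) (D v w) ⟩
      lookup (D u w) j xor lookup (D v w) j  ≡⟨ cong₂ _xor_ (lookup∘tabulate _ j) (lookup∘tabulate _ j) ⟩
      (u j xor w j) xor (v j xor w j)        ≡⟨ xor-cancelʳ (u j) (v j) (w j) ⟩
      u j xor v j                            ∎

≢⇒∈D : ∀ {ℓ} {u w : Row ℓ} {j} → u j ≢ w j → j ∈ D u w
≢⇒∈D {u = u} {w} {j} uj≢wj =
  lookup⇒[]= j (D u w) (trans (lookup∘tabulate (λ k → u k xor w k) j) (xor-≢ uj≢wj))

module LastRow {m ℓ} (T : Matrix (suc m) ℓ) where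

  last : Row ℓ
  last = T (fromℕ m)

  Δ : Fin m → Subset ℓ
  Δ i = D (T (inject₁ i)) last

  𝒯⁺ : ∀ i x → ∣ Δ i ∣ ≡ x → Δ i ∈ᴸ 𝒯 T x
  𝒯⁺ i x ∣Δi∣≡x = ∈-deduplicate⁺ (≡-dec Bool._≟_)
    (∈-filter⁺ (λ S → ∣ S ∣ ℕ.≟ x) (∈-map⁺ Δ (∈-allFin i)) ∣Δi∣≡x)

  𝒯⁻ : ∀ {x Y} → Y ∈ᴸ 𝒯 T x → ∃ λ i → Y ≡ Δ i × ∣ Δ i ∣ ≡ x
  𝒯⁻ {x} Y∈𝒯
    with ∈-filter⁻ (λ S → ∣ S ∣ ℕ.≟ x) {xs = map Δ (allFin m)}
           (∈-deduplicate⁻ (≡-dec Bool._≟_) _ Y∈𝒯)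
  ... | Y∈Δs , ∣Y∣≡x with ∈-map⁻ Δ Y∈Δs
  ... | i , _ , refl = i , refl , ∣Y∣≡x

  differs-from-last : ∀ {j} → Dirty T j → ∃ λ k → T k j ≢ last j
  differs-from-last {j} ((a , Taj≡true) , (b , Tbj≡false)) with last j
  ... | true = b , λ Tbj≡true → contradiction (trans (sym Tbj≡false) Tbj≡true) λ ()
  ... | false = a , λ Taj≡false → contradiction (trans (sym Taj≡true) Taj≡false) λ ()

  covered : ∀ {j} → Dirty T j → ∃ λ i → j ∈ Δ i
  covered {j} dirty with differs-from-last dirty
  ... | k , Tkj≢last with inject₁-onto k (λ k≡last → Tkj≢last (cong (λ k' → T k' j) k≡last))
  ... | i , refl = i , ≢⇒∈D {u = T (inject₁ i)} {w = last} Tkj≢last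

  ∣Δ∣≤3 : δ≤ T 3 → ∀ i → ∣ Δ i ∣ ≤ 3
  ∣Δ∣≤3 δ≤3 i = δ≤3 (inject₁ i) (fromℕ m) (fromℕ≢inject₁ ∘ sym)

  -- Δ i △ Δ i' = D(T[i],T[i']) by D-△; it is empty when i = i'.
  ∣Δ△Δ∣≤3 : δ≤ T 3 → ∀ i i' → ∣ Δ i △ Δ i' ∣ ≤ 3
  ∣Δ△Δ∣≤3 δ≤3 i i' with i ≟ i'
  ... | yes refl = ≤-trans (≤-reflexive ∣Δi△Δi∣≡0) z≤n
    where
      ∣Δi△Δi∣≡0 : ∣ Δ i △ Δ i ∣ ≡ 0
      ∣Δi△Δi∣≡0 = trans (∣p△q∣≡∣p─q∣+∣q─p∣ (Δ i) (Δ i)) (cong₂ _+_ (∣p─p∣≡0 (Δ i)) (∣p─p∣≡0 (Δ i)))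
  ... | no i≢i' rewrite D-△ (T (inject₁ i)) (T (inject₁ i')) last =
    δ≤3 (inject₁ i) (inject₁ i') (i≢i' ∘ inject₁-injective)

module Covering {m ℓ} (T : Matrix (suc m) ℓ) (dirty : ∀ j → Dirty T j) (δ≤3 : δ≤ T 3)
                (i₀ : Fin m) (∣S∣≡3 : ∣ LastRow.Δ T i₀ ∣ ≡ 3) where

  open LastRow T

  S : Subset ℓ
  S = Δ i₀

  half-outside-S : ∀ i → ∣ Δ i ─ S ∣ + ∣ Δ i ─ S ∣ ≤ ∣ Δ i ∣
  half-outside-S i = half-outside (Δ i) S (subst (∣ Δ i △ S ∣ ≤_) (sym ∣S∣≡3) (∣Δ△Δ∣≤3 δ≤3 i i₀))

  ∣Δ─S∣≤1 : ∀ i → ∣ Δ i ─ S ∣ ≤ 1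
  ∣Δ─S∣≤1 i = a+a≤3⇒a≤1 _ (≤-trans (half-outside-S i) (∣Δ∣≤3 δ≤3 i))

  leaves⇒2≤∣Δ∣ : ∀ {i j} → j ∈ Δ i ─ S → 2 ≤ ∣ Δ i ∣
  leaves⇒2≤∣Δ∣ {i} j∈Δi─S = ≤-trans (+-mono-≤ nonempty-outside nonempty-outside) (half-outside-S i)
    where
      nonempty-outside : 1 ≤ ∣ Δ i ─ S ∣
      nonempty-outside = x∈p⇒1≤∣p∣ j∈Δi─S

  U : ℕ → Subset ℓ
  U x = ⋃ (map (_─ S) (𝒯 T x))

  cover : ⊤ ⊆ S ∪ (U 2 ∪ U 3)
  cover {j} _ with covered (dirty j)
  ... | i , j∈Δi with j ∈? S
  ... | yes j∈S = p⊆p∪q (U 2 ∪ U 3) j∈S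
  ... | no j∉S = q⊆p∪q S (U 2 ∪ U 3) (by-size (2≤x≤3 (leaves⇒2≤∣Δ∣ j∈Δi─S) (∣Δ∣≤3 δ≤3 i)))
    where
      j∈Δi─S : j ∈ Δ i ─ S
      j∈Δi─S = x∈p∧x∉q⇒x∈p─q j∈Δi j∉S
      j∈U : ∀ x → ∣ Δ i ∣ ≡ x → j ∈ U x
      j∈U x ∣Δi∣≡x = ∈ᴸ⇒⊆⋃ (∈-map⁺ (_─ S) (𝒯⁺ i x ∣Δi∣≡x)) j∈Δi─S
      by-size : ∣ Δ i ∣ ≡ 2 ⊎ ∣ Δ i ∣ ≡ 3 → j ∈ U 2 ∪ U 3
      by-size (inj₁ ∣Δi∣≡2) = p⊆p∪q (U 3) (j∈U 2 ∣Δi∣≡2)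
      by-size (inj₂ ∣Δi∣≡3) = q⊆p∪q (U 2) (U 3) (j∈U 3 ∣Δi∣≡3)

  outside-small : ∀ x {p} → p ∈ᴸ map (_─ S) (𝒯 T x) → ∣ p ∣ ≤ 1
  outside-small x p∈ with ∈-map⁻ (_─ S) p∈
  ... | Y , Y∈𝒯 , refl with 𝒯⁻ Y∈𝒯
  ... | i , refl , _ = ∣Δ─S∣≤1 i

  ∣U∣≤∣𝒯∣ : ∀ x → ∣ U x ∣ ≤ length (𝒯 T x)
  ∣U∣≤∣𝒯∣ x = subst (∣ U x ∣ ≤_) (length-map (_─ S) (𝒯 T x))
    (∣⋃∣≤length (map (_─ S) (𝒯 T x)) (outside-small x))

  -- S itself belongs to 𝒯₃ and contributes the empty set S ─ S.
  ∣U₃∣<∣𝒯₃∣ : ∣ U 3 ∣ < length (𝒯 T 3)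
  ∣U₃∣<∣𝒯₃∣ = subst (∣ U 3 ∣ <_) (length-map (_─ S) (𝒯 T 3))
    (∣⋃∣<length (map (_─ S) (𝒯 T 3)) (outside-small 3)
       (∈-map⁺ (_─ S) (𝒯⁺ i₀ 3 ∣S∣≡3)) (∣p─p∣≡0 S))

  bound : ℓ ≤ length (𝒯 T 2) + length (𝒯 T 3) + 2
  bound = begin
    ℓ                                ≡⟨ ∣⊤∣≡n ℓ ⟨
    ∣ ⊤ {ℓ} ∣                        ≤⟨ p⊆q⇒∣p∣≤∣q∣ cover ⟩
    ∣ S ∪ (U 2 ∪ U 3) ∣              ≤⟨ ∣p∪q∣≤∣p∣+∣q∣ S (U 2 ∪ U 3) ⟩
    ∣ S ∣ + ∣ U 2 ∪ U 3 ∣            ≤⟨ +-mono-≤ (≤-reflexive ∣S∣≡3) (∣p∪q∣≤∣p∣+∣q∣ (U 2) (U 3)) ⟩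
    3 + (∣ U 2 ∣ + ∣ U 3 ∣)          ≡⟨ rearrange ∣ U 2 ∣ ∣ U 3 ∣ ⟩
    ∣ U 2 ∣ + suc ∣ U 3 ∣ + 2        ≤⟨ +-monoˡ-≤ 2 (+-mono-≤ (∣U∣≤∣𝒯∣ 2) ∣U₃∣<∣𝒯₃∣) ⟩
    length (𝒯 T 2) + length (𝒯 T 3) + 2  ∎
    where
      open ≤-Reasoning
      rearrange : ∀ a b → 3 + (a + b) ≡ a + suc b + 2
      rearrange = solve-∀

lemma14 : (m ℓ : ℕ) (T : Matrix (suc m) ℓ)
    → (∀ j → Dirty T j)
    → δ≤ T 3
    → 𝒯 T 3 ≢ []ᴸ
    → ℓ ≤ length (𝒯 T 2) + length (𝒯 T 3) + 2
lemma14 m ℓ T dirty δ≤3 𝒯₃≢[] with nonempty 𝒯₃≢[]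
... | _ , S∈𝒯₃ with LastRow.𝒯⁻ T S∈𝒯₃
... | i₀ , _ , ∣Δi₀∣≡3 = Covering.bound T dirty δ≤3 i₀ ∣Δi₀∣≡3
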